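{- (Adequacy of encoding of emptiness.) For every positive type name $t$ of the object signature, there is a bijection between the circular derivations of $t\ \mathsf{empty}$ and the canonical forms of the CoLF type $\mathtt{empty}\ \ulcorner t\urcorner$.
   Context: Positive equirecursive types: $\tau^+::=t_1^+\otimes t_2^+\mid\mathbf 1\mid t_1^+\oplus t_2^+\mid\mathbf 0$ over type names $t^+$ defined by an object signature of definitions $t^+=\tau^+$. The judgment $t\ \mathsf{empty}$ is defined coinductively (derivations may be circular/infinite) by: $\mathbf 0\ \mathsf{empty}$; if $t=t_1\oplus t_2$ in the signature and $t_1\ \mathsf{empty}$ and $t_2\ \mathsf{empty}$ then $t\ \mathsf{empty}$; if $t=t_1\otimes t_2$ and $t_1\ \mathsf{empty}$ then $t\ \mathsf{empty}$; if $t=t_1\otimes t_2$ and $t_2\ \mathsf{empty}$ then $t\ \mathsf{empty}$. CoLF encoding: postp : cotype; times : postp -> postp -> postp; one : postp; plus : postp -> postp -> postp; zero : postp; empty : postp -> cotype; zero_emp : empty zero; plus_emp : empty T1 -> empty T2 -> empty (plus T1 T2); times_emp_1 : empty T1 -> empty (times T1 T2); times_emp_2 : empty T2 -> empty (times T1 T2). Each object definition $t=\tau$ is encoded as a CoLF recursion constant $\mathtt t:\mathtt{postp}=\ulcorner\tau\urcorner$ (with times/one/plus/zero for $\otimes,\mathbf 1,\oplus,\mathbf 0$), and cycles in derivations as CoLF recursion constants; CoLF terms are identified up to their infinite unfoldings. -}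

module Defs where

-- Circularity ("derivations may be circular", "recursion constants",
-- "identified up to infinite unfoldings") is modelled with FINITE GRAPHS:
--   * a circular derivation is a finite graph of rule instances,
--   * a CoLF term with recursion constants is a finite graph of constant
--     applications (each recursion constant = one node),
-- and two graphs denote the same infinite object iff they are bisimilar.
-- Relations on finite node sets are Bool-valued (decidable), which on finite
-- graphs loses nothing (the greatest bisimulation is decidable).

open import Data.Nat using (ℕ)
open import Data.Fin using (Fin; _≟_)
open import Data.Fin.Properties using (any?)
open import Data.Bool using (Bool; T; _∧_)
open import Data.Bool.Properties using (T-∧)
open import Data.Product using (Σ; ∃; _×_; _,_; proj₁; proj₂)
open import Function.Bundles using (Equivalence)
open import Relation.Nullary.Decidable using (⌊_⌋; toWitness; fromWitness; T?)
open import Relation.Binary.PropositionalEquality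
open import Relation.Binary.Bundles using (Setoid)
open import Relation.Binary.Structures using (IsEquivalence)
open import Level using (0ℓ)

BRel : ℕ → ℕ → Set
BRel k k′ = Fin k → Fin k′ → Bool

idR : ∀ {k} → BRel k k
idR i j = ⌊ i ≟ j ⌋

idR-refl : ∀ {k} (i : Fin k) → T (idR i i)
idR-refl i = fromWitness refl

idR-≡ : ∀ {k} {i j : Fin k} → T (idR i j) → i ≡ j
idR-≡ = toWitness

convR : ∀ {k k′} → BRel k k′ → BRel k′ k
convR R j i = R i j

compR : ∀ {k k′ k″} → BRel k k′ → BRel k′ k″ → BRel k k″
compR R S i l = ⌊ any? (λ j → T? (R i j ∧ S j l)) ⌋

compR-intro : ∀ {k k′ k″} (R : BRel k k′) (S : BRel k′ k″) {i j l} →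
              T (R i j) → T (S j l) → T (compR R S i l)
compR-intro R S {j = j} r s =
  fromWitness (j , Equivalence.from T-∧ (r , s))

compR-elim : ∀ {k k′ k″} (R : BRel k k′) (S : BRel k′ k″) {i l} →
             T (compR R S i l) → ∃ λ j → T (R i j) × T (S j l)
compR-elim R S p with toWitness p
... | j , q = j , Equivalence.to T-∧ q

data PShape (A : Set) : Set where
  times : A → A → PShape A
  one   : PShape A
  plus  : A → A → PShape A
  zero  : PShape A

PosTp : ℕ → Set
PosTp n = PShape (Fin n)

ObjSig : ℕ → Set
ObjSig n = Fin n → PosTp n

data PShapeRel {A B : Set} (R : A → B → Set) : PShape A → PShape B → Set where
  times : ∀ {a b a′ b′} → R a a′ → R b b′ → PShapeRel R (times a b) (times a′ b′)
  one   : PShapeRel R one one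
  plus  : ∀ {a b a′ b′} → R a a′ → R b b′ → PShapeRel R (plus a b) (plus a′ b′)
  zero  : PShapeRel R zero zero

module _ {A B : Set} where
  PShapeRel-map : ∀ {R R′ : A → B → Set} → (∀ {a b} → R a b → R′ a b) →
                  ∀ {s s′} → PShapeRel R s s′ → PShapeRel R′ s s′
  PShapeRel-map f (times p q) = times (f p) (f q)
  PShapeRel-map f one         = one
  PShapeRel-map f (plus p q)  = plus (f p) (f q)
  PShapeRel-map f zero        = zero

  PShapeRel-sym : ∀ {R : A → B → Set} {s s′} → PShapeRel R s s′ → PShapeRel (λ b a → R a b) s′ s
  PShapeRel-sym (times p q) = times p q
  PShapeRel-sym one         = one
  PShapeRel-sym (plus p q)  = plus p q
  PShapeRel-sym zero        = zero

PShapeRel-refl : ∀ {A : Set} {R : A → A → Set} → (∀ a → R a a) → ∀ s → PShapeRel R s s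
PShapeRel-refl r (times a b) = times (r a) (r b)
PShapeRel-refl r one         = one
PShapeRel-refl r (plus a b)  = plus (r a) (r b)
PShapeRel-refl r zero        = zero

PShapeRel-trans : ∀ {A B C : Set} {R : A → B → Set} {S : B → C → Set} {s s′ s″} →
                  PShapeRel R s s′ → PShapeRel S s′ s″ →
                  PShapeRel (λ a c → ∃ λ b → R a b × S b c) s s″
PShapeRel-trans (times p q) (times p′ q′) = times (_ , p , p′) (_ , q , q′)
PShapeRel-trans one         one           = one
PShapeRel-trans (plus p q)  (plus p′ q′)  = plus (_ , p , p′) (_ , q , q′)
PShapeRel-trans zero        zero          = zero

-- finite graphs of postp-nodes (CoLF recursion constants of type postp)
record PGraph : Set where
  field
    size : ℕ
    lab  : Fin size → PShape (Fin size)

-- the object signature, read as CoLF recursion constants  t : postp = ⌜def t⌝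
sigGraph : ∀ {n} → ObjSig n → PGraph
sigGraph {n} def = record { size = n ; lab = def }

-- x in G and y in H have the same infinite unfolding (are convertible)
record PBisim (G H : PGraph) (x : Fin (PGraph.size G)) (y : Fin (PGraph.size H)) : Set where
  field
    rel    : BRel (PGraph.size G) (PGraph.size H)
    base   : T (rel x y)
    closed : ∀ i j → T (rel i j) →
             PShapeRel (λ a b → T (rel a b)) (PGraph.lab G i) (PGraph.lab H j)

module Derivations {n : ℕ} (def : ObjSig n) where

  -- a rule instance concluding  t empty  where def t = τ; premises are nodes
  -- of the derivation graph, whose conclusions are given by  name
  data Rule {K : Set} (name : K → Fin n) : PosTp n → Set where
    zero-emp   : Rule name zero
    plus-emp   : ∀ {t₁ t₂} (d₁ d₂ : K) → name d₁ ≡ t₁ → name d₂ ≡ t₂ →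
                 Rule name (plus t₁ t₂)
    times-emp₁ : ∀ {t₁ t₂} (d : K) → name d ≡ t₁ → Rule name (times t₁ t₂)
    times-emp₂ : ∀ {t₁ t₂} (d : K) → name d ≡ t₂ → Rule name (times t₁ t₂)

  record CircDeriv (t : Fin n) : Set where
    field
      size      : ℕ
      name      : Fin size → Fin n
      rule      : (i : Fin size) → Rule name (def (name i))
      root      : Fin size
      root-name : name root ≡ t

  data RuleRel {K K′ : Set} {nm : K → Fin n} {nm′ : K′ → Fin n} (R : K → K′ → Set) :
               ∀ {τ τ′} → Rule nm τ → Rule nm′ τ′ → Set where
    zero-emp   : RuleRel R zero-emp zero-emp
    plus-emp   : ∀ {t₁ t₂ t₁′ t₂′ d₁ d₂ e₁ e₂}
                   {p₁ : nm d₁ ≡ t₁} {p₂ : nm d₂ ≡ t₂} {q₁ : nm′ e₁ ≡ t₁′} {q₂ : nm′ e₂ ≡ t₂′} →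
                 R d₁ e₁ → R d₂ e₂ → RuleRel R (plus-emp d₁ d₂ p₁ p₂) (plus-emp e₁ e₂ q₁ q₂)
    times-emp₁ : ∀ {t₁ t₂ t₁′ t₂′ d e} {p : nm d ≡ t₁} {q : nm′ e ≡ t₁′} →
                 R d e → RuleRel R (times-emp₁ {t₂ = t₂} d p) (times-emp₁ {t₂ = t₂′} e q)
    times-emp₂ : ∀ {t₁ t₂ t₁′ t₂′ d e} {p : nm d ≡ t₂} {q : nm′ e ≡ t₂′} →
                 R d e → RuleRel R (times-emp₂ {t₁ = t₁} d p) (times-emp₂ {t₁ = t₁′} e q)

  record _≈D_ {t : Fin n} (D D′ : CircDeriv t) : Set where
    private
      module D  = CircDeriv D
      module D′ = CircDeriv D′
    field
      rel    : BRel D.size D′.size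
      base   : T (rel D.root D′.root)
      closed : ∀ i j → T (rel i j) →
               (D.name i ≡ D′.name j) × RuleRel (λ a b → T (rel a b)) (D.rule i) (D′.rule j)

data EShape (P E : Set) : Set where
  zero-emp   : EShape P E
  plus-emp   : P → P → E → E → EShape P E
  times-emp₁ : P → P → E → EShape P E
  times-emp₂ : P → P → E → EShape P E

data EShapeRel {P P′ E E′ : Set} (RP : P → P′ → Set) (RE : E → E′ → Set) :
               EShape P E → EShape P′ E′ → Set where
  zero-emp   : EShapeRel RP RE zero-emp zero-emp
  plus-emp   : ∀ {a b d₁ d₂ a′ b′ e₁ e₂} → RP a a′ → RP b b′ → RE d₁ e₁ → RE d₂ e₂ →
               EShapeRel RP RE (plus-emp a b d₁ d₂) (plus-emp a′ b′ e₁ e₂)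
  times-emp₁ : ∀ {a b d a′ b′ e} → RP a a′ → RP b b′ → RE d e →
               EShapeRel RP RE (times-emp₁ a b d) (times-emp₁ a′ b′ e)
  times-emp₂ : ∀ {a b d a′ b′ e} → RP a a′ → RP b b′ → RE d e →
               EShapeRel RP RE (times-emp₂ a b d) (times-emp₂ a′ b′ e)

-- a canonical CoLF term (of some type empty _), presented by finitely many
-- recursion constants: postp-constants (pGraph) and empty-constants (eLab);
-- the term itself is the empty-constant  root
record CoLFTerm : Set where
  field
    pGraph : PGraph
    eSize  : ℕ
    eLab   : Fin eSize → EShape (Fin (PGraph.size pGraph)) (Fin eSize)
    root   : Fin eSize

record _≈T_ (M M′ : CoLFTerm) : Set where
  private
    module M  = CoLFTerm M
    module M′ = CoLFTerm M′
    module G  = PGraph M.pGraph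
    module G′ = PGraph M′.pGraph
  field
    relP    : BRel G.size G′.size
    relE    : BRel M.eSize M′.eSize
    base    : T (relE M.root M′.root)
    closedP : ∀ i j → T (relP i j) → PShapeRel (λ a b → T (relP a b)) (G.lab i) (G′.lab j)
    closedE : ∀ i j → T (relE i j) →
              EShapeRel (λ a b → T (relP a b)) (λ a b → T (relE a b)) (M.eLab i) (M′.eLab j)

module Typing {n : ℕ} (def : ObjSig n) (M : CoLFTerm) where
  open CoLFTerm M
  open PGraph pGraph

  Conv : Fin size → Fin size → Set
  Conv = PBisim pGraph pGraph

  data WellTyped (ty : Fin eSize → Fin size) :
                 EShape (Fin size) (Fin eSize) → Fin size → Set where
    zero-emp   : ∀ {T₀} → lab T₀ ≡ zero → WellTyped ty zero-emp T₀
    plus-emp   : ∀ {T₀ A B T₁ T₂ D₁ D₂} → lab T₀ ≡ plus A B → Conv A T₁ → Conv B T₂ →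
                 Conv (ty D₁) T₁ → Conv (ty D₂) T₂ → WellTyped ty (plus-emp T₁ T₂ D₁ D₂) T₀
    times-emp₁ : ∀ {T₀ A B T₁ T₂ D} → lab T₀ ≡ times A B → Conv A T₁ → Conv B T₂ →
                 Conv (ty D) T₁ → WellTyped ty (times-emp₁ T₁ T₂ D) T₀
    times-emp₂ : ∀ {T₀ A B T₁ T₂ D} → lab T₀ ≡ times A B → Conv A T₁ → Conv B T₂ →
                 Conv (ty D) T₂ → WellTyped ty (times-emp₂ T₁ T₂ D) T₀

  record HasType (t : Fin n) : Set where
    field
      ty      : Fin eSize → Fin size
      typed   : ∀ e → WellTyped ty (eLab e) (ty e)
      root-ty : PBisim pGraph (sigGraph def) (ty root) t

module DerivationSetoid {n : ℕ} (def : ObjSig n) where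
  open Derivations def

  module _ {K K′ : Set} {nm : K → Fin n} {nm′ : K′ → Fin n} where
    RuleRel-map : ∀ {R R′ : K → K′ → Set} → (∀ {a b} → R a b → R′ a b) →
                  ∀ {τ τ′} {r : Rule nm τ} {r′ : Rule nm′ τ′} → RuleRel R r r′ → RuleRel R′ r r′
    RuleRel-map f zero-emp       = zero-emp
    RuleRel-map f (plus-emp p q) = plus-emp (f p) (f q)
    RuleRel-map f (times-emp₁ p) = times-emp₁ (f p)
    RuleRel-map f (times-emp₂ p) = times-emp₂ (f p)

    RuleRel-sym : ∀ {R : K → K′ → Set} {τ τ′} {r : Rule nm τ} {r′ : Rule nm′ τ′} →
                  RuleRel R r r′ → RuleRel (λ b a → R a b) r′ r
    RuleRel-sym zero-emp       = zero-emp
    RuleRel-sym (plus-emp p q) = plus-emp p q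
    RuleRel-sym (times-emp₁ p) = times-emp₁ p
    RuleRel-sym (times-emp₂ p) = times-emp₂ p

  RuleRel-refl : ∀ {K : Set} {nm : K → Fin n} {R : K → K → Set} → (∀ a → R a a) →
                 ∀ {τ} (r : Rule nm τ) → RuleRel R r r
  RuleRel-refl f zero-emp             = zero-emp
  RuleRel-refl f (plus-emp d₁ d₂ _ _) = plus-emp (f d₁) (f d₂)
  RuleRel-refl f (times-emp₁ d _)     = times-emp₁ (f d)
  RuleRel-refl f (times-emp₂ d _)     = times-emp₂ (f d)

  RuleRel-trans : ∀ {K K′ K″ : Set} {nm : K → Fin n} {nm′ : K′ → Fin n} {nm″ : K″ → Fin n}
                    {R : K → K′ → Set} {S : K′ → K″ → Set} {τ τ′ τ″}
                    {r : Rule nm τ} {r′ : Rule nm′ τ′} {r″ : Rule nm″ τ″} →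
                  RuleRel R r r′ → RuleRel S r′ r″ →
                  RuleRel (λ a c → ∃ λ b → R a b × S b c) r r″
  RuleRel-trans zero-emp       zero-emp         = zero-emp
  RuleRel-trans (plus-emp p q) (plus-emp p′ q′) = plus-emp (_ , p , p′) (_ , q , q′)
  RuleRel-trans (times-emp₁ p) (times-emp₁ p′)  = times-emp₁ (_ , p , p′)
  RuleRel-trans (times-emp₂ p) (times-emp₂ p′)  = times-emp₂ (_ , p , p′)

  ≈D-isEquivalence : ∀ {t} → IsEquivalence (_≈D_ {t})
  ≈D-isEquivalence {t} = record { refl = rf ; sym = sy ; trans = tr }
    where
    rf : ∀ {D : CircDeriv t} → D ≈D D
    rf {D} = record
      { rel = idR ; base = idR-refl _
      ; closed = λ i j p → cl i j (idR-≡ p) }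
      where
      open CircDeriv D
      cl : ∀ i j → i ≡ j → (name i ≡ name j) × RuleRel (λ a b → T (idR a b)) (rule i) (rule j)
      cl i .i refl = refl , RuleRel-refl idR-refl (rule i)
    sy : ∀ {D D′ : CircDeriv t} → D ≈D D′ → D′ ≈D D
    sy e = record
      { rel = convR rel ; base = base
      ; closed = λ i j p → sym (proj₁ (closed j i p)) , RuleRel-sym (proj₂ (closed j i p)) }
      where open _≈D_ e
    tr : ∀ {D D′ D″ : CircDeriv t} → D ≈D D′ → D′ ≈D D″ → D ≈D D″
    tr e f = record
      { rel = compR E.rel F.rel ; base = compR-intro E.rel F.rel E.base F.base
      ; closed = cl }
      where
      module E = _≈D_ e
      module F = _≈D_ f
      cl : _
      cl i l p with compR-elim E.rel F.rel p
      ... | j , q , r =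
        trans (proj₁ (E.closed i j q)) (proj₁ (F.closed j l r)) ,
        RuleRel-map (λ { (b , x , y) → compR-intro E.rel F.rel x y })
                    (RuleRel-trans (proj₂ (E.closed i j q)) (proj₂ (F.closed j l r)))

  DerivSetoid : Fin n → Setoid 0ℓ 0ℓ
  DerivSetoid t = record
    { Carrier = CircDeriv t ; _≈_ = _≈D_ ; isEquivalence = ≈D-isEquivalence }

module _ {P P′ E E′ : Set} where
  EShapeRel-map : ∀ {RP RP′ : P → P′ → Set} {RE RE′ : E → E′ → Set} →
                  (∀ {a b} → RP a b → RP′ a b) → (∀ {a b} → RE a b → RE′ a b) →
                  ∀ {s s′} → EShapeRel RP RE s s′ → EShapeRel RP′ RE′ s s′
  EShapeRel-map f g zero-emp             = zero-emp
  EShapeRel-map f g (plus-emp a b c d)   = plus-emp (f a) (f b) (g c) (g d)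
  EShapeRel-map f g (times-emp₁ a b c)   = times-emp₁ (f a) (f b) (g c)
  EShapeRel-map f g (times-emp₂ a b c)   = times-emp₂ (f a) (f b) (g c)

  EShapeRel-sym : ∀ {RP : P → P′ → Set} {RE : E → E′ → Set} {s s′} →
                  EShapeRel RP RE s s′ → EShapeRel (λ b a → RP a b) (λ b a → RE a b) s′ s
  EShapeRel-sym zero-emp           = zero-emp
  EShapeRel-sym (plus-emp a b c d) = plus-emp a b c d
  EShapeRel-sym (times-emp₁ a b c) = times-emp₁ a b c
  EShapeRel-sym (times-emp₂ a b c) = times-emp₂ a b c

EShapeRel-refl : ∀ {P E : Set} {RP : P → P → Set} {RE : E → E → Set} →
                 (∀ a → RP a a) → (∀ a → RE a a) → ∀ s → EShapeRel RP RE s s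
EShapeRel-refl f g zero-emp             = zero-emp
EShapeRel-refl f g (plus-emp a b c d)   = plus-emp (f a) (f b) (g c) (g d)
EShapeRel-refl f g (times-emp₁ a b c)   = times-emp₁ (f a) (f b) (g c)
EShapeRel-refl f g (times-emp₂ a b c)   = times-emp₂ (f a) (f b) (g c)

EShapeRel-trans : ∀ {P P′ P″ E E′ E″ : Set} {RP : P → P′ → Set} {SP : P′ → P″ → Set}
                    {RE : E → E′ → Set} {SE : E′ → E″ → Set} {s s′ s″} →
                  EShapeRel RP RE s s′ → EShapeRel SP SE s′ s″ →
                  EShapeRel (λ a c → ∃ λ b → RP a b × SP b c) (λ a c → ∃ λ b → RE a b × SE b c) s s″
EShapeRel-trans zero-emp zero-emp = zero-emp
EShapeRel-trans (plus-emp a b c d) (plus-emp a′ b′ c′ d′) =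
  plus-emp (_ , a , a′) (_ , b , b′) (_ , c , c′) (_ , d , d′)
EShapeRel-trans (times-emp₁ a b c) (times-emp₁ a′ b′ c′) =
  times-emp₁ (_ , a , a′) (_ , b , b′) (_ , c , c′)
EShapeRel-trans (times-emp₂ a b c) (times-emp₂ a′ b′ c′) =
  times-emp₂ (_ , a , a′) (_ , b , b′) (_ , c , c′)

≈T-isEquivalence : IsEquivalence _≈T_
≈T-isEquivalence = record { refl = rf ; sym = sy ; trans = tr }
  where
  rf : ∀ {M} → M ≈T M
  rf {M} = record
    { relP = idR ; relE = idR ; base = idR-refl _
    ; closedP = λ i j p → clP i j (idR-≡ p)
    ; closedE = λ i j p → clE i j (idR-≡ p) }
    where
    open CoLFTerm M
    open PGraph pGraph
    clP : ∀ i j → i ≡ j → PShapeRel (λ a b → T (idR a b)) (lab i) (lab j)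
    clP i .i refl = PShapeRel-refl idR-refl (lab i)
    clE : ∀ i j → i ≡ j → EShapeRel (λ a b → T (idR a b)) (λ a b → T (idR a b)) (eLab i) (eLab j)
    clE i .i refl = EShapeRel-refl idR-refl idR-refl (eLab i)
  sy : ∀ {M M′} → M ≈T M′ → M′ ≈T M
  sy e = record
    { relP = convR relP ; relE = convR relE ; base = base
    ; closedP = λ i j p → PShapeRel-sym (closedP j i p)
    ; closedE = λ i j p → EShapeRel-sym (closedE j i p) }
    where open _≈T_ e
  tr : ∀ {M M′ M″} → M ≈T M′ → M′ ≈T M″ → M ≈T M″
  tr e f = record
    { relP = compR E.relP F.relP ; relE = compR E.relE F.relE
    ; base = compR-intro E.relE F.relE E.base F.base
    ; closedP = clP ; closedE = clE }
    where
    module E = _≈T_ e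
    module F = _≈T_ f
    clP : _
    clP i l p with compR-elim E.relP F.relP p
    ... | j , q , r = PShapeRel-map (λ { (b , x , y) → compR-intro E.relP F.relP x y })
                        (PShapeRel-trans (E.closedP i j q) (F.closedP j l r))
    clE : _
    clE i l p with compR-elim E.relE F.relE p
    ... | j , q , r = EShapeRel-map (λ { (b , x , y) → compR-intro E.relP F.relP x y })
                                    (λ { (b , x , y) → compR-intro E.relE F.relE x y })
                        (EShapeRel-trans (E.closedE i j q) (F.closedE j l r))

CanonSetoid : ∀ {n} → ObjSig n → Fin n → Setoid 0ℓ 0ℓ
CanonSetoid def t = record
  { Carrier = Σ CoLFTerm (λ M → Typing.HasType def M t)
  ; _≈_ = λ M M′ → proj₁ M ≈T proj₁ M′
  ; isEquivalence = record
      { refl  = IsEquivalence.refl ≈T-isEquivalence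
      ; sym   = IsEquivalence.sym ≈T-isEquivalence
      ; trans = IsEquivalence.trans ≈T-isEquivalence } }

-- A derivation graph of  t empty  is already a CoLF term: keep the signature as the
-- postp-constants and turn each rule instance into the corresponding empty-constant.
-- Bisimilar derivations give bisimilar terms and conversely, since the names of
-- derivation nodes are recovered from the postp arguments of the constants.
-- For surjectivity, a well-typed term M : empty ⌜t⌝ is read back as a derivation
-- whose nodes are the pairs (e , x) of an empty-constant e of M and a type name x
-- such that the declared type of e unfolds to x.  Bisimilarity of finite graphs
-- is decidable, so this node set can be carved out of Fin eSize × Fin n.
module Submission where

open import Data.Nat using (ℕ; _*_)
open import Data.Fin using (Fin; _≟_; combine; remQuot)
open import Data.Fin.Properties using (all?; remQuot-combine)
open import Data.Fin.Subset using (Subset)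
open import Data.Fin.Subset.Properties using (anySubset?)
open import Data.Vec using (lookup; tabulate)
open import Data.Vec.Properties using (lookup∘tabulate)
open import Data.Bool using (Bool; T; _∧_)
open import Data.Bool.Properties using (T-∧)
open import Data.Product using (Σ; _×_; _,_; proj₁; proj₂; uncurry)
open import Data.Empty using (⊥-elim)
open import Function using (_∘_)
open import Function.Bundles using (Bijection; Equivalence)
open import Relation.Nullary.Decidable
  using (Dec; yes; no; map′; T?; ⌊_⌋; toWitness; fromWitness; _×-dec_; _→-dec_)
open import Relation.Binary.PropositionalEquality
open import Relation.Binary.Structures using (IsEquivalence)
open import Defs

module _ {G : PGraph} where
  PBisim-refl : ∀ x → PBisim G G x x
  PBisim-refl x = record
    { rel = idR ; base = idR-refl x ; closed = λ i j p → closed-id (idR-≡ p) }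
    where
    closed-id : ∀ {i j} → i ≡ j →
                PShapeRel (λ a b → T (idR a b)) (PGraph.lab G i) (PGraph.lab G j)
    closed-id {i} refl = PShapeRel-refl idR-refl (PGraph.lab G i)

  PBisim-reflexive : ∀ {x y} → x ≡ y → PBisim G G x y
  PBisim-reflexive {x} refl = PBisim-refl x

module _ {G H : PGraph} where
  PBisim-sym : ∀ {x y} → PBisim G H x y → PBisim H G y x
  PBisim-sym e = record
    { rel = convR rel ; base = base ; closed = λ i j p → PShapeRel-sym (closed j i p) }
    where open PBisim e

  PBisim-trans : ∀ {K : PGraph} {x y z} → PBisim G H x y → PBisim H K y z → PBisim G K x z
  PBisim-trans {K} e f = record
    { rel = compR E.rel F.rel ; base = compR-intro E.rel F.rel E.base F.base ; closed = closed }
    where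
    module E = PBisim e
    module F = PBisim f
    closed : ∀ i l → T (compR E.rel F.rel i l) →
             PShapeRel (λ a c → T (compR E.rel F.rel a c)) (PGraph.lab G i) (PGraph.lab K l)
    closed i l p with compR-elim E.rel F.rel p
    ... | j , q , r = PShapeRel-map (λ { (_ , x , y) → compR-intro E.rel F.rel x y })
                        (PShapeRel-trans (E.closed i j q) (F.closed j l r))

  PBisim-unfold : ∀ {x y} → PBisim G H x y →
                  PShapeRel (PBisim G H) (PGraph.lab G x) (PGraph.lab H y)
  PBisim-unfold e = PShapeRel-map (λ r → record { rel = rel ; base = r ; closed = closed })
                      (closed _ _ base)
    where open PBisim e

PShapeRel? : ∀ {A B : Set} {R : A → B → Set} → (∀ a b → Dec (R a b)) →
             ∀ s s′ → Dec (PShapeRel R s s′)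
PShapeRel? R? (times a b) (times a′ b′) =
  map′ (uncurry times) (λ { (times p q) → p , q }) (R? a a′ ×-dec R? b b′)
PShapeRel? R? one        one          = yes one
PShapeRel? R? (plus a b) (plus a′ b′) =
  map′ (uncurry plus) (λ { (plus p q) → p , q }) (R? a a′ ×-dec R? b b′)
PShapeRel? R? zero       zero         = yes zero
PShapeRel? R? (times _ _) one         = no λ ()
PShapeRel? R? (times _ _) (plus _ _)  = no λ ()
PShapeRel? R? (times _ _) zero        = no λ ()
PShapeRel? R? one         (times _ _) = no λ ()
PShapeRel? R? one         (plus _ _)  = no λ ()
PShapeRel? R? one         zero        = no λ ()
PShapeRel? R? (plus _ _)  (times _ _) = no λ ()
PShapeRel? R? (plus _ _)  one         = no λ ()
PShapeRel? R? (plus _ _)  zero        = no λ ()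
PShapeRel? R? zero        (times _ _) = no λ ()
PShapeRel? R? zero        one         = no λ ()
PShapeRel? R? zero        (plus _ _)  = no λ ()

module _ (G H : PGraph) where
  private
    module G = PGraph G
    module H = PGraph H

  IsBisimulation : BRel G.size H.size → Set
  IsBisimulation R = ∀ i j → T (R i j) → PShapeRel (λ a b → T (R a b)) (G.lab i) (H.lab j)

  isBisimulation? : ∀ R → Dec (IsBisimulation R)
  isBisimulation? R = all? λ i → all? λ j →
    T? (R i j) →-dec PShapeRel? (λ a b → T? (R a b)) (G.lab i) (H.lab j)

  IsBisimulation-resp : ∀ {R S} → (∀ i j → R i j ≡ S i j) →
                        IsBisimulation R → IsBisimulation S
  IsBisimulation-resp R≗S bisim i j p =
    PShapeRel-map (λ {a} {b} → subst T (R≗S a b)) (bisim i j (subst T (sym (R≗S i j)) p))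

  -- The relations between the two node sets are enumerated as subsets of
  -- their product, so the existence of a bisimulation is a finite search.
  relOf : Subset (G.size * H.size) → BRel G.size H.size
  relOf v i j = lookup v (combine i j)

  relOf-tabulate : ∀ (R : BRel G.size H.size) i j →
                   R i j ≡ relOf (tabulate (uncurry R ∘ remQuot H.size)) i j
  relOf-tabulate R i j = sym (begin
    lookup (tabulate (uncurry R ∘ remQuot H.size)) (combine i j)
      ≡⟨ lookup∘tabulate _ (combine i j) ⟩
    uncurry R (remQuot H.size (combine i j))
      ≡⟨ cong (uncurry R) (remQuot-combine i j) ⟩
    R i j ∎)
    where open ≡-Reasoning

  BisimulationAt : Fin G.size → Fin H.size → Subset (G.size * H.size) → Set
  BisimulationAt x y v = T (relOf v x y) × IsBisimulation (relOf v)

  PBisim? : ∀ x y → Dec (PBisim G H x y)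
  PBisim? x y = map′ fromSubset toSubset
    (anySubset? λ v → T? (relOf v x y) ×-dec isBisimulation? (relOf v))
    where
    fromSubset : Σ (Subset (G.size * H.size)) (BisimulationAt x y) → PBisim G H x y
    fromSubset (v , base , closed) = record { rel = relOf v ; base = base ; closed = closed }

    toSubset : PBisim G H x y → Σ (Subset (G.size * H.size)) (BisimulationAt x y)
    toSubset e = tabulate (uncurry rel ∘ remQuot H.size)
               , subst T (relOf-tabulate rel x y) base
               , IsBisimulation-resp (relOf-tabulate rel) closed
      where open PBisim e

module Encoding {n : ℕ} (def : ObjSig n) where
  open Derivations def
  open DerivationSetoid def using (RuleRel-map)

  encodeRule : ∀ {K : Set} {nm : K → Fin n} {τ} → Rule nm τ → EShape (Fin n) K
  encodeRule zero-emp                         = zero-emp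
  encodeRule (plus-emp {t₁} {t₂} d₁ d₂ _ _)   = plus-emp t₁ t₂ d₁ d₂
  encodeRule (times-emp₁ {t₁} {t₂} d _)       = times-emp₁ t₁ t₂ d
  encodeRule (times-emp₂ {t₁} {t₂} d _)       = times-emp₂ t₁ t₂ d

  encode : ∀ {t} → CircDeriv t → CoLFTerm
  encode D = record
    { pGraph = sigGraph def ; eSize = size ; eLab = encodeRule ∘ rule ; root = root }
    where open CircDeriv D

  encode-hasType : ∀ {t} (D : CircDeriv t) → Typing.HasType def (encode D) t
  encode-hasType {t} D = record
    { ty = name ; typed = λ e → ruleTyped refl (rule e) ; root-ty = PBisim-reflexive root-name }
    where
    open CircDeriv D
    open Typing def (encode D)
    ruleTyped : ∀ {x τ} → def x ≡ τ → (r : Rule name τ) → WellTyped name (encodeRule r) x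
    ruleTyped eq zero-emp             = zero-emp eq
    ruleTyped eq (plus-emp _ _ p₁ p₂) = plus-emp eq (PBisim-refl _) (PBisim-refl _)
                                          (PBisim-reflexive p₁) (PBisim-reflexive p₂)
    ruleTyped eq (times-emp₁ _ p)     = times-emp₁ eq (PBisim-refl _) (PBisim-refl _)
                                          (PBisim-reflexive p)
    ruleTyped eq (times-emp₂ _ p)     = times-emp₂ eq (PBisim-refl _) (PBisim-refl _)
                                          (PBisim-reflexive p)

  encodeRule-cong : ∀ {K K′ : Set} {nm : K → Fin n} {nm′ : K′ → Fin n}
                      {R : K → K′ → Set} {τ τ′} {r : Rule nm τ} {r′ : Rule nm′ τ′} →
                    τ ≡ τ′ → RuleRel R r r′ →
                    EShapeRel (λ a b → T (idR a b)) R (encodeRule r) (encodeRule r′)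
  encodeRule-cong refl zero-emp       = zero-emp
  encodeRule-cong refl (plus-emp p q) = plus-emp (idR-refl _) (idR-refl _) p q
  encodeRule-cong refl (times-emp₁ p) = times-emp₁ (idR-refl _) (idR-refl _) p
  encodeRule-cong refl (times-emp₂ p) = times-emp₂ (idR-refl _) (idR-refl _) p

  encodeRule-reflect : ∀ {K K′ : Set} {nm : K → Fin n} {nm′ : K′ → Fin n}
                         {RP : Fin n → Fin n → Set} {RE : K → K′ → Set} {τ τ′}
                         (r : Rule nm τ) (r′ : Rule nm′ τ′) → τ ≡ τ′ →
                       EShapeRel RP RE (encodeRule r) (encodeRule r′) →
                       RuleRel (λ a b → RE a b × nm a ≡ nm′ b) r r′
  encodeRule-reflect zero-emp zero-emp refl zero-emp = zero-emp
  encodeRule-reflect (plus-emp _ _ p₁ p₂) (plus-emp _ _ q₁ q₂) refl (plus-emp _ _ x y) =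
    plus-emp (x , trans p₁ (sym q₁)) (y , trans p₂ (sym q₂))
  encodeRule-reflect (times-emp₁ _ p) (times-emp₁ _ q) refl (times-emp₁ _ _ x) =
    times-emp₁ (x , trans p (sym q))
  encodeRule-reflect (times-emp₂ _ p) (times-emp₂ _ q) refl (times-emp₂ _ _ x) =
    times-emp₂ (x , trans p (sym q))

  encode-cong : ∀ {t} {D D′ : CircDeriv t} → D ≈D D′ → encode D ≈T encode D′
  encode-cong e = record
    { relP = idR ; relE = rel ; base = base
    ; closedP = λ i j p → closed-id (idR-≡ p)
    ; closedE = λ i j p → let (sameName , rules) = closed i j p in
                          encodeRule-cong (cong def sameName) rules }
    where
    open _≈D_ e
    closed-id : ∀ {i j} → i ≡ j → PShapeRel (λ a b → T (idR a b)) (def i) (def j)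
    closed-id {i} refl = PShapeRel-refl idR-refl (def i)

  encode-injective : ∀ {t} {D D′ : CircDeriv t} → encode D ≈T encode D′ → D ≈D D′
  encode-injective {D = D} {D′} e = record
    { rel = λ i j → relE i j ∧ ⌊ D.name i ≟ D′.name j ⌋
    ; base = Equivalence.from T-∧ (base , fromWitness (trans D.root-name (sym D′.root-name)))
    ; closed = closed }
    where
    module D  = CircDeriv D
    module D′ = CircDeriv D′
    open _≈T_ e
    closed : ∀ i j → T (relE i j ∧ ⌊ D.name i ≟ D′.name j ⌋) →
             (D.name i ≡ D′.name j) ×
             RuleRel (λ a b → T (relE a b ∧ ⌊ D.name a ≟ D′.name b ⌋)) (D.rule i) (D′.rule j)
    closed i j p with Equivalence.to T-∧ p
    ... | related , sameName =
      namesEq , RuleRel-map (λ (x , y) → Equivalence.from T-∧ (x , fromWitness y))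
                  (encodeRule-reflect (D.rule i) (D′.rule j) (cong def namesEq)
                                      (closedE i j related))
      where
      namesEq : D.name i ≡ D′.name j
      namesEq = toWitness sameName

module Decoding {n : ℕ} (def : ObjSig n) {t : Fin n}
                (M : CoLFTerm) (M-typed : Typing.HasType def M t) where
  open Derivations def
  open Encoding def using (encodeRule; encode)
  open CoLFTerm M
  open PGraph pGraph
  open Typing def M
  open HasType M-typed

  _≃_ : Fin size → Fin n → Set
  _≃_ = PBisim pGraph (sigGraph def)

  similar : Fin n → Fin size → Bool
  similar x g = ⌊ PBisim? pGraph (sigGraph def) g x ⌋

  Good : Fin eSize × Fin n → Set
  Good (e , x) = ty e ≃ x

  -- Pairs that are not good are junk nodes; they become copies of the root.
  normalise : Fin eSize × Fin n → Σ (Fin eSize × Fin n) Good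
  normalise (e , x) with PBisim? pGraph (sigGraph def) (ty e) x
  ... | yes good = (e , x) , good
  ... | no _     = (root , t) , root-ty

  normalise-good : ∀ {q} → Good q → proj₁ (normalise q) ≡ q
  normalise-good {e , x} good with PBisim? pGraph (sigGraph def) (ty e) x
  ... | yes _   = refl
  ... | no ¬good = ⊥-elim (¬good good)

  node : Fin (eSize * n) → Σ (Fin eSize × Fin n) Good
  node = normalise ∘ remQuot n

  name : Fin (eSize * n) → Fin n
  name = proj₂ ∘ proj₁ ∘ node

  tracks : Fin (eSize * n) → Fin eSize → Bool
  tracks j e = ⌊ proj₁ (proj₁ (node j)) ≟ e ⌋

  node-combine : ∀ {e x} → Good (e , x) → proj₁ (node (combine e x)) ≡ (e , x)
  node-combine {e} {x} good =
    trans (cong (proj₁ ∘ normalise) (remQuot-combine e x)) (normalise-good good)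

  name-combine : ∀ {e x} → Good (e , x) → name (combine e x) ≡ x
  name-combine = cong proj₂ ∘ node-combine

  tracks-combine : ∀ {e x} → Good (e , x) → T (tracks (combine e x) e)
  tracks-combine = fromWitness ∘ cong proj₁ ∘ node-combine

  Decoded : PosTp n → EShape (Fin size) (Fin eSize) → Set
  Decoded τ s = Σ (Rule name τ) λ r →
    EShapeRel (λ x g → T (similar x g)) (λ j e → T (tracks j e)) (encodeRule r) s

  along : ∀ {g g′ x} → Conv g g′ → g ≃ x → g′ ≃ x
  along c = PBisim-trans (PBisim-sym c)

  similar-along : ∀ {g g′ x} → Conv g g′ → g ≃ x → T (similar x g′)
  similar-along c = fromWitness ∘ along c

  relabel : ∀ {g σ τ} → lab g ≡ σ → PShapeRel _≃_ (lab g) τ → PShapeRel _≃_ σ τ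
  relabel refl r = r

  decodeRule : ∀ {g s τ} → WellTyped ty s g → PShapeRel _≃_ (lab g) τ → Decoded τ s
  decodeRule (zero-emp eq) r with relabel eq r
  ... | zero = zero-emp , zero-emp
  decodeRule (plus-emp {D₁ = D₁} {D₂} eq cA cB c₁ c₂) r with relabel eq r
  ... | plus pa pb =
    plus-emp (combine D₁ _) (combine D₂ _) (name-combine good₁) (name-combine good₂) ,
    plus-emp (similar-along cA pa) (similar-along cB pb)
             (tracks-combine good₁) (tracks-combine good₂)
    where
    good₁ : Good (D₁ , _)
    good₁ = along (PBisim-sym c₁) (along cA pa)
    good₂ : Good (D₂ , _)
    good₂ = along (PBisim-sym c₂) (along cB pb)
  decodeRule (times-emp₁ {D = D} eq cA cB c) r with relabel eq r
  ... | times pa pb =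
    times-emp₁ (combine D _) (name-combine good) ,
    times-emp₁ (similar-along cA pa) (similar-along cB pb) (tracks-combine good)
    where
    good : Good (D , _)
    good = along (PBisim-sym c) (along cA pa)
  decodeRule (times-emp₂ {D = D} eq cA cB c) r with relabel eq r
  ... | times pa pb =
    times-emp₂ (combine D _) (name-combine good) ,
    times-emp₂ (similar-along cA pa) (similar-along cB pb) (tracks-combine good)
    where
    good : Good (D , _)
    good = along (PBisim-sym c) (along cB pb)

  decodeNode : ((q , _) : Σ (Fin eSize × Fin n) Good) →
               Decoded (def (proj₂ q)) (eLab (proj₁ q))
  decodeNode ((e , x) , good) = decodeRule (typed e) (PBisim-unfold good)

  decode : CircDeriv t
  decode = record
    { size = eSize * n ; name = name ; rule = proj₁ ∘ decodeNode ∘ node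
    ; root = combine root t ; root-name = name-combine root-ty }

  encode-decode : encode decode ≈T M
  encode-decode = record
    { relP = similar ; relE = tracks ; base = tracks-combine root-ty
    ; closedP = λ x g p → PShapeRel-map (fromWitness {a? = PBisim? _ _ _ _})
                            (PShapeRel-sym (PBisim-unfold (toWitness p)))
    ; closedE = λ j e p → subst (λ e → EShapeRel _ _ _ (eLab e)) (toWitness p)
                            (proj₂ (decodeNode (node j))) }

theorem8 : (n : ℕ) (def : ObjSig n) (t : Fin n) →
    Bijection (DerivationSetoid.DerivSetoid def t) (CanonSetoid def t)
theorem8 n def t = record
  { to = λ D → encode D , encode-hasType D
  ; cong = encode-cong
  ; bijective = encode-injective , surjective }
  where
  open Encoding def
  surjective : ∀ ((M , M-typed) : Σ CoLFTerm λ M → Typing.HasType def M t) →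
               Σ (Derivations.CircDeriv def t) λ D →
                 ∀ {D′} → Derivations._≈D_ def D′ D → encode D′ ≈T M
  surjective (M , M-typed) = decode , λ D′≈decode →
    IsEquivalence.trans ≈T-isEquivalence (encode-cong D′≈decode) encode-decode
    where open Decoding def M M-typed using (decode; encode-decode)
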